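{- For every integer $n\ge4$, let $\pi\in S_n$ be the permutation $(n-2)(n-3)\cdots 2\,1\,n\,(n-1)$. Then the downcore graph of the boundary grid of $\pi$ is not pure.
   Context: For a $123$-avoiding permutation $\pi\in S_n$ (no indices $p<q<r$ with $\pi_p<\pi_q<\pi_r$), consider the points $(i,\pi_i)$ in the plane. $\pi_i$ is a left-to-right minimum if $\pi_j>\pi_i$ for all $j<i$, and a right-to-left maximum if $\pi_j<\pi_i$ for all $j>i$. The boundary grid of $\pi$ is the set of boxes $(x,y)$, $1\le x,y\le n-1$ (the box being the unit square $[x,x+1]\times[y,y+1]$, $x$ its column from the left, $y$ its row from the bottom), such that there is a left-to-right minimum $\pi_i$ with $i\le x$ and $\pi_i\le y$, and a right-to-left maximum $\pi_j$ with $j\ge x+1$ and $\pi_j\ge y+1$. The downcore graph of a set $D$ of boxes has vertex set $D$, with an edge between $(i,j)$ and $(k,\ell)$ if and only if ($i<k$ and $j>\ell$, or $i>k$ and $j<\ell$) and both $(i,\ell)$ and $(k,j)$ belong to $D$. A graph is pure if all its maximal (with respect to inclusion) independent sets have the same size. -}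

module Defs where

open import Data.Nat using (ℕ; zero; suc; _+_; _∸_; _≤_; _<_; _≤?_)
open import Data.Nat.Properties using (_≟_)
open import Data.Product using (_×_; _,_; ∃-syntax)
open import Data.Sum using (_⊎_)
open import Data.List using (List; length)
open import Data.List.Membership.Propositional using (_∈_; _∉_)
open import Data.List.Relation.Unary.Unique.Propositional using (Unique)
open import Relation.Nullary using (¬_; yes; no)
open import Relation.Binary.PropositionalEquality using (_≡_)

-- Permutations of [n] are represented (1-indexed) as functions ℕ → ℕ,
-- only the values at 1..n matter.

LRMin : (ℕ → ℕ) → ℕ → Set
LRMin π i = ∀ j → 1 ≤ j → j < i → π i < π j

RLMax : ℕ → (ℕ → ℕ) → ℕ → Set
RLMax n π j = ∀ k → j < k → k ≤ n → π k < π j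

Box : Set
Box = ℕ × ℕ

BoundaryGrid : ℕ → (ℕ → ℕ) → Box → Set
BoundaryGrid n π (x , y) =
  (1 ≤ x) × (x ≤ n ∸ 1) × (1 ≤ y) × (y ≤ n ∸ 1) ×
  (∃[ i ] ((1 ≤ i) × (i ≤ x) × LRMin π i × (π i ≤ y))) ×
  (∃[ j ] ((x + 1 ≤ j) × (j ≤ n) × RLMax n π j × (y + 1 ≤ π j)))

DowncoreAdj : (Box → Set) → Box → Box → Set
DowncoreAdj D (i , j) (k , ℓ) =
  (((i < k) × (ℓ < j)) ⊎ ((k < i) × (j < ℓ))) × D (i , ℓ) × D (k , j)

IsIndependent : {V : Set} → (V → Set) → (V → V → Set) → List V → Set
IsIndependent Vert Adj S =
  Unique S × (∀ v → v ∈ S → Vert v) × (∀ u v → u ∈ S → v ∈ S → ¬ Adj u v)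

IsMaximalIndependent : {V : Set} → (V → Set) → (V → V → Set) → List V → Set
IsMaximalIndependent Vert Adj S =
  IsIndependent Vert Adj S ×
  (∀ v → Vert v → v ∉ S → ¬ IsIndependent Vert Adj (v Data.List.∷ S))

Pure : {V : Set} → (V → Set) → (V → V → Set) → Set
Pure Vert Adj = ∀ S T → IsMaximalIndependent Vert Adj S →
  IsMaximalIndependent Vert Adj T → length S ≡ length T

DowncorePure : (Box → Set) → Set
DowncorePure D = Pure D (DowncoreAdj D)

piEx : ℕ → ℕ → ℕ
piEx n i with i ≤? n ∸ 2
... | yes _ = n ∸ 1 ∸ i
... | no _ with i ≟ n ∸ 1
...   | yes _ = n
...   | no _ = n ∸ 1

module Submission where

-- Let n = k + 4 and m = n - 1, and write π for the permutation
-- (n-2)(n-3)⋯2 1 n (n-1).  We show that the downcore graph G of the boundary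
-- grid of π has maximal independent sets of sizes |C| + 2 and |C| + 1.
--
-- Then, for fixed k, the boundary
-- grid is identified with an explicit staircase: the boxes on or above the
-- antidiagonal x + y = m in columns 1..m-1, plus the last column below the
-- top row.  The core C consists of the antidiagonal, the top row without its
-- first box, and the last column without row k+1.  Antidiagonal, top row and
-- last column carry no edges, so C ∪ {(1,m), (m,k+1)} is independent; so is
-- C ∪ {(2,k+2)}.  A classification of the staircase boxes shows that both
-- sets dominate G, hence both are maximal, and their sizes differ.

open import Defs
open import Data.Nat using (ℕ; zero; suc; _+_; _∸_; _≤_; _<_; _≤?_; _<?_; z≤n; s≤s; s≤s⁻¹)
open import Data.Nat.Properties
open import Data.Product using (_×_; _,_; ∃-syntax; proj₂)
open import Data.Sum using (_⊎_; inj₁; inj₂; [_,_]′)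
open import Data.Empty using (⊥-elim)
open import Data.List using (List; _∷_; filter; cartesianProduct; upTo)
open import Data.List.Membership.Propositional using (_∈_; _∉_)
open import Data.List.Membership.Propositional.Properties using (∈-filter⁺; ∈-filter⁻; ∈-cartesianProduct⁺; ∈-upTo⁺)
open import Data.List.Relation.Unary.Any using (here; there)
open import Data.List.Relation.Unary.All.Properties using (¬Any⇒All¬)
open import Data.List.Relation.Unary.Unique.Propositional using (Unique)
open import Data.List.Relation.Unary.Unique.Propositional.Properties using (filter⁺; cartesianProduct⁺; upTo⁺)
open import Data.List.Relation.Unary.All using (_∷_)
open import Data.List.Relation.Unary.AllPairs using (_∷_)
open import Relation.Nullary using (¬_; yes; no; Dec)
open import Relation.Nullary.Decidable using (_×-dec_; _⊎-dec_; ¬?)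
open import Relation.Binary.PropositionalEquality using (_≡_; _≢_; refl; sym; trans; subst)

module _ {V : Set} (Vert : V → Set) (Adj : V → V → Set) where

  Dominating : List V → Set
  Dominating S = ∀ v → Vert v → v ∈ S ⊎ ∃[ u ] (u ∈ S × (Adj v u ⊎ Adj u v))

  dominating⇒maximal : ∀ {S} → IsIndependent Vert Adj S → Dominating S →
                       IsMaximalIndependent Vert Adj S
  dominating⇒maximal {S} indep dom = indep , cannot-extend
    where
    cannot-extend : ∀ v → Vert v → v ∉ S → ¬ IsIndependent Vert Adj (v ∷ S)
    cannot-extend v vert v∉S (_ , _ , noAdj) with dom v vert
    ... | inj₁ v∈S = v∉S v∈S
    ... | inj₂ (u , u∈S , inj₁ vu) = noAdj v u (here refl) (there u∈S) vu
    ... | inj₂ (u , u∈S , inj₂ uv) = noAdj u v (there u∈S) (here refl) uv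

Edge : (Box → Set) → Box → Box → Set
Edge E (i , j) (k , l) = i < k × l < j × E (i , l) × E (k , j)

module _ {D E : Box → Set} where

  adj⇒edge : (∀ {v} → D v → E v) → ∀ u w → DowncoreAdj D u w → Edge E u w ⊎ Edge E w u
  adj⇒edge D⇒E _ _ (inj₁ (i<k , l<j) , d-il , d-kj) = inj₁ (i<k , l<j , D⇒E d-il , D⇒E d-kj)
  adj⇒edge D⇒E _ _ (inj₂ (k<i , j<l) , d-il , d-kj) = inj₂ (k<i , j<l , D⇒E d-kj , D⇒E d-il)

  edge⇒adj : (∀ {v} → E v → D v) → ∀ {u w} → Edge E u w → DowncoreAdj D u w
  edge⇒adj E⇒D (i<k , l<j , e-il , e-kj) = inj₁ (i<k , l<j) , E⇒D e-il , E⇒D e-kj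

  downcore-independent : (∀ {v} → D v → E v) → ∀ {S} → Unique S → (∀ {v} → v ∈ S → D v) →
                         (∀ {u w} → u ∈ S → w ∈ S → ¬ Edge E u w) →
                         IsIndependent D (DowncoreAdj D) S
  downcore-independent D⇒E uniq vert noEdge =
    uniq , (λ _ → vert) ,
    λ u w u∈S w∈S adj → [ noEdge u∈S w∈S , noEdge w∈S u∈S ]′ (adj⇒edge D⇒E u w adj)

-- The boundary grid phrases strict bounds as a + 1 ≤ b.
<⇒+1≤ : ∀ {a b} → a < b → a + 1 ≤ b
<⇒+1≤ {a} {b} a<b = subst (_≤ b) (+-comm 1 a) a<b

+1≤⇒< : ∀ {a b} → a + 1 ≤ b → a < b
+1≤⇒< {a} {b} a+1≤b = subst (_≤ b) (+-comm a 1) a+1≤b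

module Example (k : ℕ) where

  m n : ℕ
  m = 3 + k
  n = 4 + k

  π : ℕ → ℕ
  π = piEx n

  π-low : ∀ {i} → i ≤ 2 + k → π i ≡ m ∸ i
  π-low {i} i≤ with i ≤? 2 + k
  ... | yes _ = refl
  ... | no i≰ = ⊥-elim (i≰ i≤)

  π-m : π m ≡ n
  π-m with m ≤? 2 + k
  ... | yes m≤ = ⊥-elim (<-irrefl refl m≤)
  ... | no _ with m ≟ m
  ...   | yes _ = refl
  ...   | no m≢m = ⊥-elim (m≢m refl)

  π-n : π n ≡ m
  π-n with n ≤? 2 + k
  ... | yes n≤ = ⊥-elim (<-irrefl refl (≤-trans (n≤1+n _) n≤))
  ... | no _ with n ≟ m
  ...   | yes n≡m = ⊥-elim (1+n≢n n≡m)
  ...   | no _ = refl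

  π-last : π (2 + k) ≡ 1
  π-last = trans (π-low ≤-refl) (m+n∸n≡m 1 k)

  lrmin : ∀ {i} → i ≤ 2 + k → LRMin π i
  lrmin {i} i≤ j _ j<i rewrite π-low i≤ | π-low (≤-trans (<⇒≤ j<i) i≤) =
    ∸-monoʳ-< j<i (≤-trans i≤ (n≤1+n _))

  rlmax-m : RLMax n π m
  rlmax-m j m<j j≤n with ≤-antisym j≤n m<j
  ... | refl rewrite π-n | π-m = n<1+n m

  rlmax-n : RLMax n π n
  rlmax-n j n<j j≤n = ⊥-elim (<⇒≱ n<j j≤n)

  Stair : Box → Set
  Stair (x , y) = (1 ≤ x × x < m × m ≤ x + y × y ≤ m) ⊎ (x ≡ m × 1 ≤ y × y < m)

  positive-height : ∀ {x y} → x < m → m ≤ x + y → 1 ≤ y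
  positive-height {x} {zero} x<m m≤x = ⊥-elim (<⇒≱ x<m (subst (m ≤_) (+-identityʳ x) m≤x))
  positive-height {y = suc _} _ _ = s≤s z≤n

  -- Before the last column
  -- a left-to-right minimum i ≤ x with π i = m - i ≤ y puts (x , y) on or
  -- above the antidiagonal; in the last column the right-to-left maximum must
  -- be π n = m, which keeps y below the top row.  Conversely, x itself and m
  -- (resp. m - 1 and n) witness membership.
  grid⇒stair : ∀ {v} → BoundaryGrid n π v → Stair v
  grid⇒stair {x , y} (1≤x , x≤m , 1≤y , y≤m , (i , _ , i≤x , _ , πi≤y) , (j , x+1≤j , j≤n , _ , y+1≤πj))
    with x <? m
  ... | yes x<m = inj₁ (1≤x , x<m , m≤x+y , y≤m)
    where
    m≤x+y : m ≤ x + y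
    m≤x+y = ≤-trans (m≤n+m∸n m i)
              (+-mono-≤ i≤x (subst (_≤ y) (π-low (≤-trans i≤x (s≤s⁻¹ x<m))) πi≤y))
  ... | no x≮m with ≤-antisym x≤m (≮⇒≥ x≮m)
  ...   | refl with ≤-antisym j≤n (subst (_≤ j) (+-comm m 1) x+1≤j)
  ...     | refl = inj₂ (refl , 1≤y , +1≤⇒< (subst (y + 1 ≤_) π-n y+1≤πj))

  stair⇒grid : ∀ {v} → Stair v → BoundaryGrid n π v
  stair⇒grid {x , y} (inj₁ (1≤x , x<m , m≤x+y , y≤m)) =
    1≤x , <⇒≤ x<m , positive-height x<m m≤x+y , y≤m ,
    (x , 1≤x , ≤-refl , lrmin x≤2+k ,
      subst (_≤ y) (sym (π-low x≤2+k)) (m≤n+o⇒m∸n≤o m x m≤x+y)) ,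
    (m , <⇒+1≤ x<m , n≤1+n m , rlmax-m ,
      subst (y + 1 ≤_) (sym π-m) (<⇒+1≤ (s≤s y≤m)))
    where
    x≤2+k : x ≤ 2 + k
    x≤2+k = s≤s⁻¹ x<m
  stair⇒grid {x , y} (inj₂ (refl , 1≤y , y<m)) =
    s≤s z≤n , ≤-refl , 1≤y , <⇒≤ y<m ,
    (2 + k , s≤s z≤n , n≤1+n _ , lrmin ≤-refl , subst (_≤ y) (sym π-last) 1≤y) ,
    (n , <⇒+1≤ ≤-refl , ≤-refl , rlmax-n , subst (y + 1 ≤_) (sym π-n) (<⇒+1≤ y<m))

  stair-y≤m : ∀ {x y} → Stair (x , y) → y ≤ m
  stair-y≤m (inj₁ (_ , _ , _ , y≤m)) = y≤m
  stair-y≤m (inj₂ (_ , _ , y<m)) = <⇒≤ y<m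

  stair-x≤m : ∀ {x y} → Stair (x , y) → x ≤ m
  stair-x≤m (inj₁ (_ , x<m , _)) = <⇒≤ x<m
  stair-x≤m (inj₂ (refl , _)) = ≤-refl

  stair-last-column : ∀ {y} → Stair (m , y) → y < m
  stair-last-column (inj₁ (_ , m<m , _)) = ⊥-elim (<-irrefl refl m<m)
  stair-last-column (inj₂ (_ , _ , y<m)) = y<m

  -- The lower-left corner of a staircase edge lies on or above the antidiagonal,
  -- since its column is not the last one.
  edge-above-antidiagonal : ∀ {i j k l} → Edge Stair (i , j) (k , l) → m ≤ i + l
  edge-above-antidiagonal (_ , _ , inj₁ (_ , _ , m≤i+l , _) , _) = m≤i+l
  edge-above-antidiagonal (i<k , _ , inj₂ (refl , _) , s-kj) = ⊥-elim (<⇒≱ i<k (stair-x≤m s-kj))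

  no-edge-from-antidiagonal : ∀ {i j k l} → Edge Stair (i , j) (k , l) → i + j ≢ m
  no-edge-from-antidiagonal {i} {l = l} e@(_ , l<j , _) i+j≡m =
    <⇒≱ (subst (i + l <_) i+j≡m (+-monoʳ-< i l<j)) (edge-above-antidiagonal e)

  no-edge-into-antidiagonal : ∀ {i j k l} → Edge Stair (i , j) (k , l) → k + l ≢ m
  no-edge-into-antidiagonal {i} {l = l} e@(i<k , _) k+l≡m =
    <⇒≱ (subst (i + l <_) k+l≡m (+-monoˡ-< l i<k)) (edge-above-antidiagonal e)

  Frame : Box → Set
  Frame (x , y) = x + y ≡ m ⊎ y ≡ m ⊎ x ≡ m

  frame-no-edge : ∀ {u w} → Frame u → Frame w → ¬ Edge Stair u w
  frame-no-edge _ (inj₁ k+l≡m) e = no-edge-into-antidiagonal e k+l≡m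
  frame-no-edge _ (inj₂ (inj₁ refl)) (_ , m<j , _ , s-kj) = <⇒≱ m<j (stair-y≤m s-kj)
  frame-no-edge (inj₁ i+j≡m) (inj₂ (inj₂ refl)) e = no-edge-from-antidiagonal e i+j≡m
  frame-no-edge (inj₂ (inj₁ refl)) (inj₂ (inj₂ refl)) (_ , _ , _ , s-kj) =
    <-irrefl refl (stair-last-column s-kj)
  frame-no-edge (inj₂ (inj₂ refl)) (inj₂ (inj₂ refl)) (m<m , _) = <-irrefl refl m<m

  InCore : Box → Set
  InCore (x , y) = (1 ≤ x × x < m × x + y ≡ m) ⊎ (2 ≤ x × x < m × y ≡ m) ⊎
                   (x ≡ m × 1 ≤ y × y < m × y ≢ 1 + k)

  inCore? : ∀ v → Dec (InCore v)
  inCore? (x , y) = (1 ≤? x ×-dec x <? m ×-dec x + y ≟ m) ⊎-dec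
                    (2 ≤? x ×-dec x <? m ×-dec y ≟ m) ⊎-dec
                    (x ≟ m ×-dec 1 ≤? y ×-dec y <? m ×-dec ¬? (y ≟ 1 + k))

  core-frame : ∀ {v} → InCore v → Frame v
  core-frame (inj₁ (_ , _ , x+y≡m)) = inj₁ x+y≡m
  core-frame (inj₂ (inj₁ (_ , _ , y≡m))) = inj₂ (inj₁ y≡m)
  core-frame (inj₂ (inj₂ (x≡m , _))) = inj₂ (inj₂ x≡m)

  core-stair : ∀ {v} → InCore v → Stair v
  core-stair {x , y} (inj₁ (1≤x , x<m , x+y≡m)) =
    inj₁ (1≤x , x<m , subst (m ≤_) (sym x+y≡m) ≤-refl , subst (y ≤_) x+y≡m (m≤n+m y x))
  core-stair {x , y} (inj₂ (inj₁ (2≤x , x<m , refl))) =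
    inj₁ (≤-trans (n≤1+n 1) 2≤x , x<m , m≤n+m m x , ≤-refl)
  core-stair (inj₂ (inj₂ (x≡m , 1≤y , y<m , _))) = inj₂ (x≡m , 1≤y , y<m)

  board : List Box
  board = cartesianProduct (upTo (suc m)) (upTo (suc m))

  core : List Box
  core = filter inCore? board

  core-unique : Unique core
  core-unique = filter⁺ inCore? {xs = board} (cartesianProduct⁺ (upTo⁺ (suc m)) (upTo⁺ (suc m)))

  ∈core⇒InCore : ∀ {v} → v ∈ core → InCore v
  ∈core⇒InCore v∈ = proj₂ (∈-filter⁻ inCore? {xs = board} v∈)

  InCore⇒∈core : ∀ {v} → InCore v → v ∈ core
  InCore⇒∈core {x , y} c =
    ∈-filter⁺ inCore? (∈-cartesianProduct⁺ (∈-upTo⁺ (s≤s x≤m)) (∈-upTo⁺ (s≤s y≤m))) c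
    where
    x≤m : x ≤ m
    x≤m = stair-x≤m (core-stair c)
    y≤m : y ≤ m
    y≤m = stair-y≤m (core-stair c)

  top-left gap inner : Box
  top-left = (1 , m)
  gap = (m , 1 + k)
  inner = (2 , 2 + k)

  1<m : 1 < m
  1<m = s≤s (s≤s z≤n)

  2<m : 2 < m
  2<m = s≤s (s≤s (s≤s z≤n))

  top-row-stair : ∀ {x} → 1 ≤ x → x < m → Stair (x , m)
  top-row-stair {x} 1≤x x<m = inj₁ (1≤x , x<m , m≤n+m m x , ≤-refl)

  last-column-stair : ∀ {y} → 1 ≤ y → y < m → Stair (m , y)
  last-column-stair 1≤y y<m = inj₂ (refl , 1≤y , y<m)

  row-edge-gap : ∀ {x} → 2 ≤ x → x < m → Edge Stair (x , 2 + k) gap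
  row-edge-gap 2≤x x<m =
    x<m , ≤-refl , inj₁ (≤-trans (n≤1+n 1) 2≤x , x<m , +-monoˡ-≤ (1 + k) 2≤x , m≤n+m (1 + k) 2) ,
    last-column-stair (s≤s z≤n) ≤-refl

  top-left-edge-inner : Edge Stair top-left inner
  top-left-edge-inner =
    ≤-refl , ≤-refl , inj₁ (≤-refl , 1<m , ≤-refl , n≤1+n _) , top-row-stair (s≤s z≤n) 2<m

  inner-edge-gap : Edge Stair inner gap
  inner-edge-gap = row-edge-gap ≤-refl 2<m

  top-row-edge-row : ∀ {x} → 2 < x → x < m → Edge Stair (2 , m) (x , 2 + k)
  top-row-edge-row 2<x x<m =
    2<x , ≤-refl , inj₁ (s≤s z≤n , 2<m , n≤1+n _ , n≤1+n _) ,
    top-row-stair (≤-trans (s≤s z≤n) 2<x) x<m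

  inner-no-edge-core : ∀ {w} → InCore w → ¬ Edge Stair inner w
  inner-no-edge-core (inj₁ (_ , _ , k+l≡m)) e = no-edge-into-antidiagonal e k+l≡m
  inner-no-edge-core (inj₂ (inj₁ (_ , _ , refl))) (_ , m<2+k , _) = <⇒≱ m<2+k (n≤1+n _)
  inner-no-edge-core {_ , l} (inj₂ (inj₂ (_ , _ , _ , l≢1+k))) e@(_ , l<2+k , _) =
    l≢1+k (≤-antisym (s≤s⁻¹ l<2+k) (s≤s⁻¹ (s≤s⁻¹ (edge-above-antidiagonal e))))

  core-no-edge-inner : ∀ {u} → InCore u → ¬ Edge Stair u inner
  core-no-edge-inner (inj₁ (_ , _ , i+j≡m)) e = no-edge-from-antidiagonal e i+j≡m
  core-no-edge-inner (inj₂ (inj₁ (2≤i , _))) (i<2 , _) = <⇒≱ i<2 2≤i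
  core-no-edge-inner (inj₂ (inj₂ (refl , _))) (m<2 , _) = <⇒≱ m<2 (<⇒≤ 2<m)

  -- The ways a staircase box can be dominated: it is in the core, it is the
  -- top-left or the gap box, it lies in row m-1 right of the antidiagonal, or
  -- it starts an edge into the core.
  data Shape : Box → Set where
    core-box : ∀ {v} → InCore v → Shape v
    top-left-box : Shape top-left
    gap-box : Shape gap
    row-box : ∀ {x} → 2 ≤ x → x < m → Shape (x , 2 + k)
    covered : ∀ {v u} → InCore u → Edge Stair v u → Shape v

  classify-top-row : ∀ {x} → 1 ≤ x → x < m → Shape (x , m)
  classify-top-row {x} 1≤x x<m with x ≟ 1
  ... | yes refl = top-left-box
  ... | no x≢1 = core-box (inj₂ (inj₁ (≤∧≢⇒< 1≤x (λ 1≡x → x≢1 (sym 1≡x)) , x<m , refl)))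

  -- A box (x , y'+1) strictly inside the triangle starts an edge to the
  -- last-column box (m , y'), which is in the core unless y' = k+1.
  classify-interior-row : ∀ {x y'} → 1 ≤ x → x < m → m ≤ x + y' → suc y' < m → Shape (x , suc y')
  classify-interior-row {x} {y'} 1≤x x<m m≤x+y' 1+y'<m with y' ≟ 1 + k
  ... | yes refl = row-box (+-cancelʳ-≤ (1 + k) 2 x m≤x+y') x<m
  ... | no y'≢1+k =
    covered (inj₂ (inj₂ (refl , positive-height x<m m≤x+y' , y'<m , y'≢1+k)))
            (x<m , n<1+n y' , inj₁ (1≤x , x<m , m≤x+y' , <⇒≤ y'<m) ,
             last-column-stair (s≤s z≤n) 1+y'<m)
    where
    y'<m : y' < m
    y'<m = <-trans (n<1+n y') 1+y'<m

  classify-interior : ∀ {x y} → 1 ≤ x → x < m → m < x + y → y < m → Shape (x , y)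
  classify-interior {x} {zero} _ x<m m<x _ =
    ⊥-elim (<-asym x<m (subst (m <_) (+-identityʳ x) m<x))
  classify-interior {x} {suc y'} 1≤x x<m m<x+1+y' 1+y'<m =
    classify-interior-row 1≤x x<m (s≤s⁻¹ (subst (m <_) (+-suc x y') m<x+1+y')) 1+y'<m

  classify : ∀ {v} → Stair v → Shape v
  classify {_ , y} (inj₂ (refl , 1≤y , y<m)) with y ≟ 1 + k
  ... | yes refl = gap-box
  ... | no y≢1+k = core-box (inj₂ (inj₂ (refl , 1≤y , y<m , y≢1+k)))
  classify {x , y} (inj₁ (1≤x , x<m , m≤x+y , y≤m)) with x + y ≟ m
  ... | yes x+y≡m = core-box (inj₁ (1≤x , x<m , x+y≡m))
  ... | no x+y≢m with y ≟ m
  ...   | yes refl = classify-top-row 1≤x x<m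
  ...   | no y≢m =
    classify-interior 1≤x x<m (≤∧≢⇒< m≤x+y (λ m≡x+y → x+y≢m (sym m≡x+y))) (≤∧≢⇒< y≤m y≢m)

  G : Box → Set
  G = BoundaryGrid n π

  adj : ∀ {u w} → Edge Stair u w → DowncoreAdj G u w
  adj = edge⇒adj stair⇒grid

  ¬core-top-left : ¬ InCore top-left
  ¬core-top-left (inj₁ (_ , _ , 1+m≡m)) = 1+n≢n 1+m≡m
  ¬core-top-left (inj₂ (inj₁ (s≤s () , _)))
  ¬core-top-left (inj₂ (inj₂ (() , _)))

  ¬core-gap : ¬ InCore gap
  ¬core-gap (inj₁ (_ , m<m , _)) = <-irrefl refl m<m
  ¬core-gap (inj₂ (inj₁ (_ , m<m , _))) = <-irrefl refl m<m
  ¬core-gap (inj₂ (inj₂ (_ , _ , _ , 1+k≢1+k))) = 1+k≢1+k refl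

  ¬core-inner : ¬ InCore inner
  ¬core-inner (inj₁ (_ , _ , 4+k≡m)) = 1+n≢n 4+k≡m
  ¬core-inner (inj₂ (inj₁ (_ , _ , 2+k≡m))) = 1+n≢n (sym 2+k≡m)
  ¬core-inner (inj₂ (inj₂ (() , _)))

  -- First maximal independent set: the core with the top-left and gap boxes.
  -- It lies in the frame, so it is independent.
  S₁ : List Box
  S₁ = top-left ∷ gap ∷ core

  S₁-frame : ∀ {v} → v ∈ S₁ → Frame v
  S₁-frame (here refl) = inj₂ (inj₁ refl)
  S₁-frame (there (here refl)) = inj₂ (inj₂ refl)
  S₁-frame (there (there v∈core)) = core-frame (∈core⇒InCore v∈core)

  S₁-stair : ∀ {v} → v ∈ S₁ → Stair v
  S₁-stair (here refl) = top-row-stair (s≤s z≤n) 1<m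
  S₁-stair (there (here refl)) = last-column-stair (s≤s z≤n) (n≤1+n _)
  S₁-stair (there (there v∈core)) = core-stair (∈core⇒InCore v∈core)

  S₁-unique : Unique S₁
  S₁-unique = ((λ ()) ∷ ¬Any⇒All¬ core (λ p → ¬core-top-left (∈core⇒InCore p)))
            ∷ ¬Any⇒All¬ core (λ p → ¬core-gap (∈core⇒InCore p))
            ∷ core-unique

  maximal₁ : IsMaximalIndependent G (DowncoreAdj G) S₁
  maximal₁ = dominating⇒maximal G (DowncoreAdj G) independent dominating
    where
    independent : IsIndependent G (DowncoreAdj G) S₁
    independent = downcore-independent grid⇒stair S₁-unique (λ p → stair⇒grid (S₁-stair p))
                    (λ p q → frame-no-edge (S₁-frame p) (S₁-frame q))
    dominating : Dominating G (DowncoreAdj G) S₁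
    dominating v g with classify (grid⇒stair g)
    ... | core-box c = inj₁ (there (there (InCore⇒∈core c)))
    ... | top-left-box = inj₁ (here refl)
    ... | gap-box = inj₁ (there (here refl))
    ... | row-box 2≤x x<m = inj₂ (gap , there (here refl) , inj₁ (adj (row-edge-gap 2≤x x<m)))
    ... | covered c e = inj₂ (_ , there (there (InCore⇒∈core c)) , inj₁ (adj e))

  S₂ : List Box
  S₂ = inner ∷ core

  S₂-member : ∀ {v} → v ∈ S₂ → v ≡ inner ⊎ InCore v
  S₂-member (here refl) = inj₁ refl
  S₂-member (there v∈core) = inj₂ (∈core⇒InCore v∈core)

  S₂-stair : ∀ {v} → v ≡ inner ⊎ InCore v → Stair v
  S₂-stair (inj₁ refl) = inj₁ (s≤s z≤n , 2<m , n≤1+n _ , n≤1+n _)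
  S₂-stair (inj₂ c) = core-stair c

  S₂-no-edge : ∀ {u w} → u ≡ inner ⊎ InCore u → w ≡ inner ⊎ InCore w → ¬ Edge Stair u w
  S₂-no-edge (inj₁ refl) (inj₁ refl) (2<2 , _) = <-irrefl refl 2<2
  S₂-no-edge (inj₁ refl) (inj₂ cw) = inner-no-edge-core cw
  S₂-no-edge (inj₂ cu) (inj₁ refl) = core-no-edge-inner cu
  S₂-no-edge (inj₂ cu) (inj₂ cw) = frame-no-edge (core-frame cu) (core-frame cw)

  maximal₂ : IsMaximalIndependent G (DowncoreAdj G) S₂
  maximal₂ = dominating⇒maximal G (DowncoreAdj G) independent dominating
    where
    independent : IsIndependent G (DowncoreAdj G) S₂
    independent = downcore-independent grid⇒stair
                    (¬Any⇒All¬ core (λ p → ¬core-inner (∈core⇒InCore p)) ∷ core-unique)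
                    (λ p → stair⇒grid (S₂-stair (S₂-member p)))
                    (λ p q → S₂-no-edge (S₂-member p) (S₂-member q))
    dominating : Dominating G (DowncoreAdj G) S₂
    dominating v g with classify (grid⇒stair g)
    ... | core-box c = inj₁ (there (InCore⇒∈core c))
    ... | top-left-box = inj₂ (inner , here refl , inj₁ (adj top-left-edge-inner))
    ... | gap-box = inj₂ (inner , here refl , inj₂ (adj inner-edge-gap))
    ... | covered c e = inj₂ (_ , there (InCore⇒∈core c) , inj₁ (adj e))
    ... | row-box {x} 2≤x x<m with x ≟ 2
    ...   | yes refl = inj₁ (here refl)
    ...   | no x≢2 =
      inj₂ ((2 , m) , there (InCore⇒∈core (inj₂ (inj₁ (≤-refl , 2<m , refl)))) ,
            inj₂ (adj (top-row-edge-row (≤∧≢⇒< 2≤x (λ 2≡x → x≢2 (sym 2≡x))) x<m)))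

-- The two maximal independent sets have sizes |core| + 2 and |core| + 1.
lemma3p11 : ∀ (n : ℕ) → 4 ≤ n → ¬ DowncorePure (BoundaryGrid n (piEx n))
lemma3p11 _ (s≤s (s≤s (s≤s (s≤s (z≤n {k}))))) pure = 1+n≢n (pure S₁ S₂ maximal₁ maximal₂)
  where open Example k
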